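{- Let $\ell$ be a prime, $s$ a positive integer, and $s'=\lceil s/2\rceil$. Let $H\subseteq\mathrm{GL}_2(\mathbb{Z}/\ell^s\mathbb{Z})$ be an abelian subgroup. Then there exists $A'\in M_2(\mathbb{Z}/\ell^s\mathbb{Z})$ whose reduction modulo $\ell$ is not a scalar matrix such that the image of $H$ in $M_2(\mathbb{Z}/\ell^{s'}\mathbb{Z})$ (reduction modulo $\ell^{s'}$) is contained in the subring generated by $I$ and $A'\bmod \ell^{s'}$. Consequently $\#H\le\ell^{3s}$. -}

module Defs where

open import Data.Nat using (ℕ)
open import Data.Integer using (ℤ; +_; _+_; _*_; -_; _-_)
open import Data.Integer.Divisibility using (_∣_)
open import Data.Product using (_×_; ∃)

-- 2×2 matrices with integer entries; an element of M₂(ℤ/mℤ) is represented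
-- by any integer matrix, and equality in M₂(ℤ/mℤ) is entrywise congruence mod m.
record Mat : Set where
  constructor mat
  field
    a b c d : ℤ
open Mat public

infixl 6 _+ᴹ_
infixl 7 _*ᴹ_
infix 4 _≈_[mod_] _≡ℤ_[mod_]

_+ᴹ_ : Mat → Mat → Mat
mat a b c d +ᴹ mat a' b' c' d' = mat (a + a') (b + b') (c + c') (d + d')

-ᴹ_ : Mat → Mat
-ᴹ mat a b c d = mat (- a) (- b) (- c) (- d)

_*ᴹ_ : Mat → Mat → Mat
mat a b c d *ᴹ mat a' b' c' d' =
  mat (a * a' + b * c') (a * b' + b * d') (c * a' + d * c') (c * b' + d * d')

scalar : ℤ → Mat
scalar x = mat x (+ 0) (+ 0) x

I : Mat
I = scalar (+ 1)

_≡ℤ_[mod_] : ℤ → ℤ → ℕ → Set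
x ≡ℤ y [mod m ] = (+ m) ∣ (x - y)

_≈_[mod_] : Mat → Mat → ℕ → Set
X ≈ Y [mod m ] =
  (a X ≡ℤ a Y [mod m ]) × (b X ≡ℤ b Y [mod m ]) ×
  (c X ≡ℤ c Y [mod m ]) × (d X ≡ℤ d Y [mod m ])

IsInvertible : ℕ → Mat → Set
IsInvertible m X = ∃ λ (Y : Mat) → (X *ᴹ Y ≈ I [mod m ]) × (Y *ᴹ X ≈ I [mod m ])

IsScalarMod : ℕ → Mat → Set
IsScalarMod m X = ∃ λ (x : ℤ) → X ≈ scalar x [mod m ]

data InSubring (m : ℕ) (B : Mat) : Mat → Set where
  gen-I   : ∀ {X} → X ≈ I [mod m ] → InSubring m B X
  gen-B   : ∀ {X} → X ≈ B [mod m ] → InSubring m B X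
  closed+ : ∀ {X Y Z} → InSubring m B X → InSubring m B Y →
            Z ≈ X +ᴹ Y [mod m ] → InSubring m B Z
  closed- : ∀ {X Z} → InSubring m B X →
            Z ≈ -ᴹ X [mod m ] → InSubring m B Z
  closed* : ∀ {X Y Z} → InSubring m B X → InSubring m B Y →
            Z ≈ X *ᴹ Y [mod m ] → InSubring m B Z

{-# OPTIONS --safe #-}
-- Choose X ∈ H that is not scalar modulo ℓ^k, k = ⌈s/2⌉, and write X = x I + ℓ^i B with i < k
-- maximal, so that B is not scalar modulo ℓ. Anything commuting with X modulo ℓ^s commutes with
-- B modulo ℓ^(s−i), hence modulo ℓ^k as i + k ≤ s, and the centralizer of B modulo ℓ^k is
-- {x I + y B} because one of a − d, b, c of B is a unit. (If all of H is scalar modulo ℓ^k, any B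
-- that is not scalar modulo ℓ works.) For the count, write X = x I + y B + ℓ^k W with
-- 0 ≤ x, y < ℓ^k: then X modulo ℓ^s is determined by x, y and W modulo ℓ^⌊s/2⌋, so
-- #H ≤ ℓ^(2k + 4⌊s/2⌋) ≤ ℓ^(3s).
module Submission where

open import Defs
open import Data.Empty using (⊥-elim)
open import Data.Fin as Fin using (Fin; toℕ; fromℕ<; combine)
import Data.Fin.Properties as Fin
open import Data.Integer using (ℤ; +_; -[1+_])
open import Data.Integer.DivMod using (_%ℕ_; n%ℕd<d)
open import Data.List using (List; []; _∷_; length; lookup)
open import Data.List.Membership.Propositional using (_∈_; find)
open import Data.List.Membership.Propositional.Properties using (∈-lookup)
open import Data.List.Relation.Unary.All as All using (All; all?)
open import Data.List.Relation.Unary.All.Properties using (¬All⇒Any¬)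
open import Data.List.Relation.Unary.AllPairs using (AllPairs; []; _∷_)
open import Data.Product using (_×_; _,_; ∃; ∃₂)
open import Data.Sum using (_⊎_; inj₁; inj₂; [_,_]′)
open import Function using (_∘_)
open import Relation.Nullary using (¬_; Dec; yes; no)
open import Relation.Nullary.Decidable using (map′; _×-dec_)
open import Relation.Binary.PropositionalEquality
  using (_≡_; refl; sym; trans; cong; cong₂; subst; subst₂; module ≡-Reasoning)

-- The integer arithmetic lives in this anonymous module so that the operators of ℤ do not clash
-- with those of ℕ, which the statement of the theorem uses.
module _ where
  open import Data.Integer using (_+_; _*_; -_; _-_)
  open import Data.Integer.Properties
    using (pos-*; *-assoc; *-comm; *-zeroʳ; +-identityˡ; +-identityʳ; +-inverseʳ)
  import Data.Integer.Divisibility as Unsigned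
  open import Data.Integer.Divisibility.Signed
    using (_∣_; _∣?_; divides; quotient; ∣ᵤ⇒∣; ∣⇒∣ᵤ; ∣m∣n⇒∣m+n; ∣n⇒∣m*n)
  open import Data.Integer.DivMod using (_/ℕ_; a≡a%ℕn+[a/ℕn]*n)
  open import Data.Integer.Tactic.RingSolver using (solve)
  open import Data.Nat as ℕ using (ℕ; zero; suc; _^_; NonZero)
  import Data.Nat.Divisibility as ℕ
  open import Data.Nat.Coprimality using (Coprime; coprime-Bézout; coprime-divisor)
  open import Data.Nat.GCD using (module Bézout)
  open import Data.Nat.Primality using (Prime; prime⇒irreducible; prime⇒nonTrivial)
  open ≡-Reasoning

  ∣-linear₁ : ∀ {k x z : ℤ} u → k ∣ x → z ≡ u * x → k ∣ z
  ∣-linear₁ u k∣x refl = ∣n⇒∣m*n u k∣x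

  ∣-linear₂ : ∀ {k x y z : ℤ} u v → k ∣ x → k ∣ y → z ≡ u * x + v * y → k ∣ z
  ∣-linear₂ u v k∣x k∣y refl = ∣m∣n⇒∣m+n (∣n⇒∣m*n u k∣x) (∣n⇒∣m*n v k∣y)

  ∣-*ʳ : ∀ {n z} k → n ∣ z → n * k ∣ z * k
  ∣-*ʳ {n} k (divides q refl) = divides q (*-assoc q n k)

  ∣-*-cancelˡ : ∀ {m n z} .{{_ : NonZero m}} → + (m ℕ.* n) ∣ + m * z → + n ∣ z
  ∣-*-cancelˡ {m} {n} {z} mn∣mz =
    ∣ᵤ⇒∣ (Unsigned.*-cancelˡ-∣ (+ m) (subst (Unsigned._∣ + m * z) (pos-* m n) (∣⇒∣ᵤ mn∣mz)))

  prime-∤⇒coprime : ∀ {ℓ n} → Prime ℓ → ¬ ℓ ℕ.∣ n → Coprime ℓ n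
  prime-∤⇒coprime ℓ-prime ℓ∤n (j∣ℓ , j∣n) with prime⇒irreducible ℓ-prime j∣ℓ
  ... | inj₁ j≡1 = j≡1
  ... | inj₂ refl = ⊥-elim (ℓ∤n j∣n)

  coprime-^ˡ : ∀ {ℓ n} → Coprime ℓ n → ∀ k → Coprime (ℓ ^ k) n
  coprime-^ˡ ℓ⊥n zero (j∣1 , _) = ℕ.∣1⇒≡1 j∣1
  coprime-^ˡ {ℓ} ℓ⊥n (suc k) {j} (j∣ℓℓᵏ , j∣n) =
    coprime-^ˡ ℓ⊥n k (coprime-divisor j⊥ℓ j∣ℓℓᵏ , j∣n)
    where
    j⊥ℓ : Coprime j ℓ
    j⊥ℓ (i∣j , i∣ℓ) = ℓ⊥n (i∣ℓ , ℕ.∣-trans i∣j j∣n)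

  pos-1+*≡* : ∀ a b c d → 1 ℕ.+ a ℕ.* b ≡ c ℕ.* d → + 1 + + a * + b ≡ + c * + d
  pos-1+*≡* a b c d e = begin
    + 1 + + a * + b   ≡⟨ cong (λ z → + 1 + z) (pos-* a b) ⟨
    + (1 ℕ.+ a ℕ.* b) ≡⟨ cong +_ e ⟩
    + (c ℕ.* d)       ≡⟨ pos-* c d ⟩
    + c * + d         ∎

  coprime⇒inverse : ∀ {m n} → Coprime m n → ∃ λ v → + m ∣ + n * v - + 1
  coprime⇒inverse {m} {n} m⊥n with coprime-Bézout m⊥n
  ... | Bézout.+- x y eq = - + y , divides (- + x) (negated (+ n) (+ y) (+ x) (+ m) (pos-1+*≡* y n x m eq))
    where
    negated : ∀ N Y X M → + 1 + Y * N ≡ X * M → N * - Y - + 1 ≡ - X * M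
    negated N Y X M e = begin
      N * - Y - + 1   ≡⟨ solve (N ∷ Y ∷ []) ⟩
      - (+ 1 + Y * N) ≡⟨ cong -_ e ⟩
      - (X * M)       ≡⟨ solve (X ∷ M ∷ []) ⟩
      - X * M         ∎
  ... | Bézout.-+ x y eq = + y , divides (+ x) (shifted (+ n) (+ y) (+ x) (+ m) (pos-1+*≡* x m y n eq))
    where
    shifted : ∀ N Y X M → + 1 + X * M ≡ Y * N → N * Y - + 1 ≡ X * M
    shifted N Y X M e = begin
      N * Y - + 1       ≡⟨ solve (N ∷ Y ∷ []) ⟩
      Y * N - + 1       ≡⟨ cong (_- + 1) e ⟨
      + 1 + X * M - + 1 ≡⟨ solve (X ∷ M ∷ []) ⟩
      X * M             ∎

  prime-unit-inverse : ∀ {ℓ u} → Prime ℓ → ¬ + ℓ ∣ u → ∀ k → ∃ λ v → + (ℓ ^ k) ∣ u * v - + 1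
  prime-unit-inverse {ℓ} {u} ℓ-prime ℓ∤u k
    with coprime⇒inverse (coprime-^ˡ (prime-∤⇒coprime ℓ-prime (ℓ∤u ∘ ∣ᵤ⇒∣)) k)
  prime-unit-inverse {u = + n} _ _ _ | v , ℓᵏ∣ = v , ℓᵏ∣
  prime-unit-inverse {u = -[1+ n ]} _ _ _ | v , ℓᵏ∣ = - v , subst (_ ∣_) (signs (+ suc n) v) ℓᵏ∣
    where
    signs : ∀ N v → N * v - + 1 ≡ - N * - v - + 1
    signs N v = solve (N ∷ v ∷ [])

  ≡ℤ⇒∣ : ∀ {m} x y → x ≡ℤ y [mod m ] → + m ∣ x - y
  ≡ℤ⇒∣ x y = ∣ᵤ⇒∣

  ≡ℤ-refl : ∀ {m} x → x ≡ℤ x [mod m ]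
  ≡ℤ-refl {m} x = ∣⇒∣ᵤ {+ m} (divides (+ 0) (+-inverseʳ x))

  ≡ℤ-sym : ∀ {m x y} → x ≡ℤ y [mod m ] → y ≡ℤ x [mod m ]
  ≡ℤ-sym {x = x} {y} x≡y =
    ∣⇒∣ᵤ (∣-linear₁ {z = y - x} (- + 1) (≡ℤ⇒∣ x y x≡y) (solve (x ∷ y ∷ [])))

  ≡ℤ-trans : ∀ {m x y z} → x ≡ℤ y [mod m ] → y ≡ℤ z [mod m ] → x ≡ℤ z [mod m ]
  ≡ℤ-trans {x = x} {y} {z} x≡y y≡z =
    ∣⇒∣ᵤ (∣-linear₂ {z = x - z} (+ 1) (+ 1) (≡ℤ⇒∣ x y x≡y) (≡ℤ⇒∣ y z y≡z)
                    (solve (x ∷ y ∷ z ∷ [])))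

  ≡ℤ-%ℕ : ∀ z n .{{_ : NonZero n}} → z ≡ℤ + (z %ℕ n) [mod n ]
  ≡ℤ-%ℕ z n =
    ∣⇒∣ᵤ (divides (z /ℕ n) (remainder (+ (z %ℕ n)) (z /ℕ n) (+ n) (a≡a%ℕn+[a/ℕn]*n z n)))
    where
    remainder : ∀ {z} r q N → z ≡ r + q * N → z - r ≡ q * N
    remainder r q N refl = solve (r ∷ q ∷ N ∷ [])

  ≡ℤ-lift : ∀ {m n} z z′ r (h : + m ∣ z - r) (h′ : + m ∣ z′ - r) →
            quotient h ≡ℤ quotient h′ [mod n ] → z ≡ℤ z′ [mod m ℕ.* n ]
  ≡ℤ-lift {m} {n} z z′ r (divides w e) (divides w′ e′) w≡w′ =
    ∣⇒∣ᵤ (subst₂ _∣_ modulus (sym (factor z z′ r w w′ (+ m) e e′))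
                  (∣-*ʳ (+ m) (≡ℤ⇒∣ w w′ w≡w′)))
    where
    modulus : + n * + m ≡ + (m ℕ.* n)
    modulus = trans (*-comm (+ n) (+ m)) (sym (pos-* m n))
    factor : ∀ z z′ r w w′ M → z - r ≡ w * M → z′ - r ≡ w′ * M → z - z′ ≡ (w - w′) * M
    factor z z′ r w w′ M e e′ = begin
      z - z′             ≡⟨ solve (z ∷ z′ ∷ r ∷ []) ⟩
      (z - r) - (z′ - r) ≡⟨ cong₂ _-_ e e′ ⟩
      w * M - w′ * M     ≡⟨ solve (w ∷ w′ ∷ M ∷ []) ⟩
      (w - w′) * M       ∎

  infix 6 _I+_∙_
  infix 4 _∣⁅_,_⁆

  _I+_∙_ : ℤ → ℤ → Mat → Mat
  x I+ y ∙ mat α β γ δ = mat (x + y * α) (y * β) (y * γ) (x + y * δ)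

  InSpan : ℕ → Mat → Mat → Set
  InSpan m B X = ∃₂ λ x y → X ≈ x I+ y ∙ B [mod m ]

  -- The (1,1), (1,2) and (2,1) entries of X Y − Y X for X = (α β; γ δ) and Y = (p q; r t);
  -- its (2,2) entry is minus the (1,1) entry.
  _∣⁅_,_⁆ : ℕ → Mat → Mat → Set
  m ∣⁅ mat α β γ δ , mat p q r t ⁆ =
    + m ∣ β * r - q * γ × + m ∣ (α - δ) * q - β * (p - t) × + m ∣ γ * (p - t) - (α - δ) * r

  mat-≡ : ∀ {p q r t p′ q′ r′ t′} → p ≡ p′ → q ≡ q′ → r ≡ r′ → t ≡ t′ →
          mat p q r t ≡ mat p′ q′ r′ t′
  mat-≡ refl refl refl refl = refl

  ≈-refl : ∀ {m} X → X ≈ X [mod m ]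
  ≈-refl X = ≡ℤ-refl (a X) , ≡ℤ-refl (b X) , ≡ℤ-refl (c X) , ≡ℤ-refl (d X)

  ≈-reflexive : ∀ {m X Y} → X ≡ Y → X ≈ Y [mod m ]
  ≈-reflexive {X = X} refl = ≈-refl X

  ≈-trans : ∀ {m X Y Z} → X ≈ Y [mod m ] → Y ≈ Z [mod m ] → X ≈ Z [mod m ]
  ≈-trans {X = X} {Y} {Z} (xa , xb , xc , xd) (ya , yb , yc , yd) =
    ≡ℤ-trans {x = a X} {a Y} {a Z} xa ya , ≡ℤ-trans {x = b X} {b Y} {b Z} xb yb ,
    ≡ℤ-trans {x = c X} {c Y} {c Z} xc yc , ≡ℤ-trans {x = d X} {d Y} {d Z} xd yd

  ≈-weaken : ∀ {m n X Y} → n ℕ.∣ m → X ≈ Y [mod m ] → X ≈ Y [mod n ]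
  ≈-weaken n∣m (pa , pb , pc , pd) =
    ℕ.∣-trans n∣m pa , ℕ.∣-trans n∣m pb , ℕ.∣-trans n∣m pc , ℕ.∣-trans n∣m pd

  I+∙-cong : ∀ {m x x′ y y′} B → x ≡ℤ x′ [mod m ] → y ≡ℤ y′ [mod m ] →
             x I+ y ∙ B ≈ x′ I+ y′ ∙ B [mod m ]
  I+∙-cong {m} {x} {x′} {y} {y′} (mat α β γ δ) x≡x′ y≡y′ =
    ∣⇒∣ᵤ (∣-linear₂ {z = x + y * α - (x′ + y′ * α)} (+ 1) α x≡ y≡
                    (solve (x ∷ x′ ∷ y ∷ y′ ∷ α ∷ []))) ,
    ∣⇒∣ᵤ (∣-linear₁ {z = y * β - y′ * β} β y≡ (solve (y ∷ y′ ∷ β ∷ []))) ,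
    ∣⇒∣ᵤ (∣-linear₁ {z = y * γ - y′ * γ} γ y≡ (solve (y ∷ y′ ∷ γ ∷ []))) ,
    ∣⇒∣ᵤ (∣-linear₂ {z = x + y * δ - (x′ + y′ * δ)} (+ 1) δ x≡ y≡
                    (solve (x ∷ x′ ∷ y ∷ y′ ∷ δ ∷ [])))
    where
    x≡ : + m ∣ x - x′
    x≡ = ≡ℤ⇒∣ x x′ x≡x′
    y≡ : + m ∣ y - y′
    y≡ = ≡ℤ⇒∣ y y′ y≡y′

  quotientᴹ : ∀ {m} X Y → X ≈ Y [mod m ] → Mat
  quotientᴹ X Y (ha , hb , hc , hd) =
    mat (quotient (≡ℤ⇒∣ (a X) (a Y) ha)) (quotient (≡ℤ⇒∣ (b X) (b Y) hb))
        (quotient (≡ℤ⇒∣ (c X) (c Y) hc)) (quotient (≡ℤ⇒∣ (d X) (d Y) hd))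

  ≈-lift : ∀ {m n} X X′ R (h : X ≈ R [mod m ]) (h′ : X′ ≈ R [mod m ]) →
           quotientᴹ X R h ≈ quotientᴹ X′ R h′ [mod n ] → X ≈ X′ [mod m ℕ.* n ]
  ≈-lift X X′ R (ha , hb , hc , hd) (ha′ , hb′ , hc′ , hd′) (qa , qb , qc , qd) =
    ≡ℤ-lift (a X) (a X′) (a R) (≡ℤ⇒∣ (a X) (a R) ha) (≡ℤ⇒∣ (a X′) (a R) ha′) qa ,
    ≡ℤ-lift (b X) (b X′) (b R) (≡ℤ⇒∣ (b X) (b R) hb) (≡ℤ⇒∣ (b X′) (b R) hb′) qb ,
    ≡ℤ-lift (c X) (c X′) (c R) (≡ℤ⇒∣ (c X) (c R) hc) (≡ℤ⇒∣ (c X′) (c R) hc′) qc ,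
    ≡ℤ-lift (d X) (d X′) (d R) (≡ℤ⇒∣ (d X) (d R) hd) (≡ℤ⇒∣ (d X′) (d R) hd′) qd

  inSpan-intro : ∀ {m} B Y x y → + m ∣ a Y - (x + y * a B) → + m ∣ b Y - y * b B → + m ∣ c Y - y * c B →
                 + m ∣ d Y - (x + y * d B) → InSpan m B Y
  inSpan-intro (mat _ _ _ _) (mat _ _ _ _) x y ha hb hc hd =
    x , y , ∣⇒∣ᵤ ha , ∣⇒∣ᵤ hb , ∣⇒∣ᵤ hc , ∣⇒∣ᵤ hd

  scalar∈subring : ∀ {m B} x → InSubring m B (scalar x)
  scalar∈subring (+ n) = natural∈subring n
    where
    natural∈subring : ∀ {m B} n → InSubring m B (scalar (+ n))
    natural∈subring zero =
      closed+ {X = I} {Y = -ᴹ I} (gen-I (≈-refl I)) (closed- {X = I} (gen-I (≈-refl I)) (≈-refl (-ᴹ I)))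
              (≈-refl (scalar (+ 0)))
    natural∈subring (suc n) =
      closed+ {X = I} {scalar (+ n)} (gen-I (≈-refl I)) (natural∈subring n) (≈-refl (scalar (+ suc n)))
  scalar∈subring -[1+ n ] =
    closed- {X = scalar (+ suc n)} (scalar∈subring (+ suc n)) (≈-refl (scalar -[1+ n ]))

  inSpan⇒inSubring : ∀ {m B X} → InSpan m B X → InSubring m B X
  inSpan⇒inSubring {B = B} {X} (x , y , X≈) =
    closed+ {X = scalar x} {scalar y *ᴹ B} (scalar∈subring x)
            (closed* {X = scalar y} {B} (scalar∈subring y) (gen-B (≈-refl B)) (≈-refl (scalar y *ᴹ B)))
            (≈-trans {X = X} {x I+ y ∙ B} X≈ (≈-reflexive (I+∙≡ B)))
    where
    I+∙≡ : ∀ B → x I+ y ∙ B ≡ scalar x +ᴹ scalar y *ᴹ B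
    I+∙≡ (mat α β γ δ) = mat-≡ (cong (_+_ x) (sym (+-identityʳ (y * α))))
                               (sym (trans (+-identityˡ _) (+-identityʳ (y * β))))
                               (sym (trans (+-identityˡ _) (+-identityˡ (y * γ))))
                               (cong (_+_ x) (sym (+-identityˡ (y * δ))))

  isScalarMod⇒∣ : ∀ {m} X → IsScalarMod m X → + m ∣ a X - d X × + m ∣ b X × + m ∣ c X
  isScalarMod⇒∣ (mat p q r t) (x , ha , hb , hc , hd) =
    ∣-linear₂ (+ 1) (- + 1) (≡ℤ⇒∣ p x ha) (≡ℤ⇒∣ t x hd) (solve (p ∷ t ∷ x ∷ [])) ,
    ∣-linear₁ (+ 1) (≡ℤ⇒∣ q (+ 0) hb) (solve (q ∷ [])) ,
    ∣-linear₁ (+ 1) (≡ℤ⇒∣ r (+ 0) hc) (solve (r ∷ []))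

  ∣⇒isScalarMod : ∀ {m} X → + m ∣ a X - d X → + m ∣ b X → + m ∣ c X → IsScalarMod m X
  ∣⇒isScalarMod (mat p q r t) m∣p-t m∣q m∣r =
    t , ∣⇒∣ᵤ m∣p-t , ∣⇒∣ᵤ (∣-linear₁ {z = q - + 0} (+ 1) m∣q (solve (q ∷ []))) ,
        ∣⇒∣ᵤ (∣-linear₁ {z = r - + 0} (+ 1) m∣r (solve (r ∷ []))) ,
        ∣⇒∣ᵤ (∣-linear₁ {z = t - t} (+ 0) m∣p-t (solve (p ∷ t ∷ [])))

  isScalarMod? : ∀ m X → Dec (IsScalarMod m X)
  isScalarMod? m X = map′ (λ (h₁ , h₂ , h₃) → ∣⇒isScalarMod X h₁ h₂ h₃) (isScalarMod⇒∣ X)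
    (+ m ∣? a X - d X ×-dec + m ∣? b X ×-dec + m ∣? c X)

  ¬isScalarMod⇒∤ : ∀ {m} X → ¬ IsScalarMod m X → ¬ + m ∣ a X - d X ⊎ ¬ + m ∣ b X ⊎ ¬ + m ∣ c X
  ¬isScalarMod⇒∤ {m} X ¬scalar with + m ∣? a X - d X | + m ∣? b X | + m ∣? c X
  ... | no ∤a-d  | _      | _      = inj₁ ∤a-d
  ... | yes _    | no ∤b  | _      = inj₂ (inj₁ ∤b)
  ... | yes _    | yes _  | no ∤c  = inj₂ (inj₂ ∤c)
  ... | yes ∣a-d | yes ∣b | yes ∣c = ⊥-elim (¬scalar (∣⇒isScalarMod X ∣a-d ∣b ∣c))

  isScalarMod⇒I+∙ : ∀ {m} X → IsScalarMod m X → ∃₂ λ x B → X ≡ x I+ + m ∙ B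
  isScalarMod⇒I+∙ {m} (mat p q r t) scalar with isScalarMod⇒∣ (mat p q r t) scalar
  ... | divides e p-t≡em , divides β refl , divides γ refl =
    t , mat e β γ (+ 0) , mat-≡ p≡ (*-comm β (+ m)) (*-comm γ (+ m)) (sym t+m0≡t)
    where
    p≡ : p ≡ t + + m * e
    p≡ = begin
      p             ≡⟨ solve (p ∷ t ∷ []) ⟩
      t + (p - t)   ≡⟨ cong (_+_ t) p-t≡em ⟩
      t + e * + m   ≡⟨ cong (_+_ t) (*-comm e (+ m)) ⟩
      t + + m * e   ∎
    t+m0≡t : t + + m * + 0 ≡ t
    t+m0≡t = trans (cong (_+_ t) (*-zeroʳ (+ m))) (+-identityʳ t)

  isScalarMod-I+∙ : ∀ {n m} x B → IsScalarMod n B → IsScalarMod (n ℕ.* m) (x I+ + m ∙ B)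
  isScalarMod-I+∙ {n} {m} x (mat α β γ δ) scalar with isScalarMod⇒∣ (mat α β γ δ) scalar
  ... | n∣α-δ , n∣β , n∣γ =
    ∣⇒isScalarMod (x I+ M ∙ mat α β γ δ)
      (scaled (difference M) n∣α-δ) (scaled (*-comm M β) n∣β) (scaled (*-comm M γ) n∣γ)
    where
    M : ℤ
    M = + m
    scaled : ∀ {z w} → w ≡ z * M → + n ∣ z → + (n ℕ.* m) ∣ w
    scaled {z} refl n∣z = subst (_∣ z * M) (sym (pos-* n m)) (∣-*ʳ M n∣z)
    difference : ∀ k → x + k * α - (x + k * δ) ≡ (α - δ) * k
    difference k = solve (x ∷ k ∷ α ∷ δ ∷ [])

  isScalarMod⇒inSpan : ∀ {m} B X → IsScalarMod m X → InSpan m B X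
  isScalarMod⇒inSpan (mat α β γ δ) (mat p q r t) (x , ha , hb , hc , hd) =
    inSpan-intro (mat α β γ δ) (mat p q r t) x (+ 0)
      (∣-linear₁ (+ 1) (≡ℤ⇒∣ p x ha) (solve (p ∷ x ∷ α ∷ [])))
      (∣-linear₁ (+ 1) (≡ℤ⇒∣ q (+ 0) hb) (solve (q ∷ β ∷ [])))
      (∣-linear₁ (+ 1) (≡ℤ⇒∣ r (+ 0) hc) (solve (r ∷ γ ∷ [])))
      (∣-linear₁ (+ 1) (≡ℤ⇒∣ t x hd) (solve (t ∷ x ∷ δ ∷ [])))

  E₁₂ : Mat
  E₁₂ = mat (+ 0) (+ 1) (+ 0) (+ 0)

  E₁₂-nonScalarMod : ∀ {ℓ} → Prime ℓ → ¬ IsScalarMod ℓ E₁₂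
  E₁₂-nonScalarMod ℓ-prime scalar with isScalarMod⇒∣ E₁₂ scalar
  ... | _ , ℓ∣1 , _ = ℕ.nonTrivial⇒≢1 {{prime⇒nonTrivial ℓ-prime}} (ℕ.∣1⇒≡1 (∣⇒∣ᵤ ℓ∣1))

  commute⇒∣⁅⁆ : ∀ {m} X Y → X *ᴹ Y ≈ Y *ᴹ X [mod m ] → m ∣⁅ X , Y ⁆
  commute⇒∣⁅⁆ (mat α β γ δ) (mat p q r t) (ha , hb , hc , _) =
    ∣-linear₁ (+ 1) (≡ℤ⇒∣ (α * p + β * r) (p * α + q * γ) ha)
              (solve (α ∷ β ∷ γ ∷ p ∷ q ∷ r ∷ [])) ,
    ∣-linear₁ (+ 1) (≡ℤ⇒∣ (α * q + β * t) (p * β + q * δ) hb)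
              (solve (α ∷ β ∷ δ ∷ p ∷ q ∷ t ∷ [])) ,
    ∣-linear₁ (+ 1) (≡ℤ⇒∣ (γ * p + δ * r) (r * α + t * γ) hc)
              (solve (α ∷ γ ∷ δ ∷ p ∷ r ∷ t ∷ []))

  ∣⁅⁆-I+∙ : ∀ {m n} .{{_ : NonZero m}} x B Y → (m ℕ.* n) ∣⁅ x I+ + m ∙ B , Y ⁆ → n ∣⁅ B , Y ⁆
  ∣⁅⁆-I+∙ {m} {n} x (mat α β γ δ) (mat p q r t) (κ₁ , κ₂ , κ₃) =
    ∣-*-cancelˡ (subst (_ ∣_) (scaled₁ (+ m)) κ₁) ,
    ∣-*-cancelˡ (subst (_ ∣_) (scaled₂ (+ m)) κ₂) ,
    ∣-*-cancelˡ (subst (_ ∣_) (scaled₃ (+ m)) κ₃)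
    where
    scaled₁ : ∀ M → M * β * r - q * (M * γ) ≡ M * (β * r - q * γ)
    scaled₁ M = solve (M ∷ β ∷ γ ∷ q ∷ r ∷ [])
    scaled₂ : ∀ M → (x + M * α - (x + M * δ)) * q - M * β * (p - t) ≡ M * ((α - δ) * q - β * (p - t))
    scaled₂ M = solve (x ∷ M ∷ α ∷ β ∷ δ ∷ p ∷ q ∷ t ∷ [])
    scaled₃ : ∀ M → M * γ * (p - t) - (x + M * α - (x + M * δ)) * r ≡ M * (γ * (p - t) - (α - δ) * r)
    scaled₃ M = solve (x ∷ M ∷ α ∷ γ ∷ δ ∷ p ∷ r ∷ t ∷ [])

  -- If a − d, b or c of B is a unit v⁻¹ modulo m, the matching entry of Y determines y
  -- (y = (p − t) v, q v or r v), x = t − y δ, and the commutator entries give the other congruences.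
  centralizer-a-d : ∀ {m} B Y → (∃ λ v → + m ∣ (a B - d B) * v - + 1) → m ∣⁅ B , Y ⁆ → InSpan m B Y
  centralizer-a-d (mat α β γ δ) (mat p q r t) (v , u) (κ₁ , κ₂ , κ₃) =
    inSpan-intro (mat α β γ δ) (mat p q r t) (t - (p - t) * v * δ) ((p - t) * v)
      (∣-linear₁ (- (p - t)) u (solve (α ∷ δ ∷ p ∷ t ∷ v ∷ [])))
      (∣-linear₂ v (- q) κ₂ u (solve (α ∷ β ∷ δ ∷ p ∷ q ∷ t ∷ v ∷ [])))
      (∣-linear₂ (- v) (- r) κ₃ u (solve (α ∷ γ ∷ δ ∷ p ∷ r ∷ t ∷ v ∷ [])))
      (∣-linear₁ (+ 0) u (solve (α ∷ δ ∷ p ∷ t ∷ v ∷ [])))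

  centralizer-b : ∀ {m} B Y → (∃ λ v → + m ∣ b B * v - + 1) → m ∣⁅ B , Y ⁆ → InSpan m B Y
  centralizer-b (mat α β γ δ) (mat p q r t) (v , u) (κ₁ , κ₂ , κ₃) =
    inSpan-intro (mat α β γ δ) (mat p q r t) (t - q * v * δ) (q * v)
      (∣-linear₂ (- v) (- (p - t)) κ₂ u (solve (α ∷ β ∷ δ ∷ p ∷ q ∷ t ∷ v ∷ [])))
      (∣-linear₁ (- q) u (solve (β ∷ q ∷ v ∷ [])))
      (∣-linear₂ v (- r) κ₁ u (solve (β ∷ γ ∷ q ∷ r ∷ v ∷ [])))
      (∣-linear₁ (+ 0) u (solve (β ∷ δ ∷ q ∷ t ∷ v ∷ [])))

  centralizer-c : ∀ {m} B Y → (∃ λ v → + m ∣ c B * v - + 1) → m ∣⁅ B , Y ⁆ → InSpan m B Y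
  centralizer-c (mat α β γ δ) (mat p q r t) (v , u) (κ₁ , κ₂ , κ₃) =
    inSpan-intro (mat α β γ δ) (mat p q r t) (t - r * v * δ) (r * v)
      (∣-linear₂ v (- (p - t)) κ₃ u (solve (α ∷ γ ∷ δ ∷ p ∷ r ∷ t ∷ v ∷ [])))
      (∣-linear₂ (- v) (- q) κ₁ u (solve (β ∷ γ ∷ q ∷ r ∷ v ∷ [])))
      (∣-linear₁ (- r) u (solve (γ ∷ r ∷ v ∷ [])))
      (∣-linear₁ (+ 0) u (solve (γ ∷ δ ∷ r ∷ t ∷ v ∷ [])))

  centralizer : ∀ {ℓ k} B Y → Prime ℓ → ¬ IsScalarMod ℓ B → (ℓ ^ k) ∣⁅ B , Y ⁆ → InSpan (ℓ ^ k) B Y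
  centralizer {ℓ} {k} B Y ℓ-prime ¬scalar κ =
    [ (λ ℓ∤a-d → centralizer-a-d B Y (inverse ℓ∤a-d) κ)
    , [ (λ ℓ∤b → centralizer-b B Y (inverse ℓ∤b) κ)
      , (λ ℓ∤c → centralizer-c B Y (inverse ℓ∤c) κ)
      ]′
    ]′ (¬isScalarMod⇒∤ B ¬scalar)
    where
    inverse : ∀ {u} → ¬ + ℓ ∣ u → ∃ λ v → + (ℓ ^ k) ∣ u * v - + 1
    inverse ℓ∤u = prime-unit-inverse ℓ-prime ℓ∤u k

open import Data.Nat using (ℕ; zero; suc; _+_; _*_; _^_; _≤_; _<_; s≤s⁻¹; ⌈_/2⌉; ⌊_/2⌋; NonZero)
open import Data.Nat.Divisibility using (_∣_; 1∣_; m∣m*n)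
import Data.Nat.Properties as ℕ
open import Data.Nat.Primality using (Prime; prime⇒nonZero)
import Data.Nat.Tactic.RingSolver as ℕ-Ring

^-monoʳ-∣ : ∀ ℓ {i j} → i ≤ j → ℓ ^ i ∣ ℓ ^ j
^-monoʳ-∣ ℓ {i} {j} i≤j = subst (λ k → ℓ ^ i ∣ ℓ ^ k) (ℕ.m+[n∸m]≡n i≤j)
  (subst (ℓ ^ i ∣_) (sym (ℕ.^-distribˡ-+-* ℓ i _)) (m∣m*n _))

∃-boundary : ∀ {P : ℕ → Set} → (∀ i → Dec (P i)) → P 0 → ∀ {n} → ¬ P n →
             ∃ λ i → i < n × P i × ¬ P (suc i)
∃-boundary P? P0 {zero} ¬P0 = ⊥-elim (¬P0 P0)
∃-boundary P? P0 {suc n} ¬Pn+1 with P? n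
... | yes Pn = n , ℕ.n<1+n n , Pn , ¬Pn+1
... | no ¬Pn with ∃-boundary P? P0 ¬Pn
... | i , i<n , Pi , ¬Pi+1 = i , ℕ.m<n⇒m<1+n i<n , Pi , ¬Pi+1

isScalarMod-1 : ∀ X → IsScalarMod 1 X
isScalarMod-1 X = + 0 , 1∣ _ , 1∣ _ , 1∣ _ , 1∣ _

centralizer-I+∙ : ∀ {ℓ i k s} x B Y → Prime ℓ → ¬ IsScalarMod ℓ B → i + k ≤ s →
  (x I+ + (ℓ ^ i) ∙ B) *ᴹ Y ≈ Y *ᴹ (x I+ + (ℓ ^ i) ∙ B) [mod ℓ ^ s ] → InSpan (ℓ ^ k) B Y
centralizer-I+∙ {ℓ} {i} {k} {s} x B Y ℓ-prime ¬scalar i+k≤s XY≈YX =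
  centralizer {k = k} B Y ℓ-prime ¬scalar (∣⁅⁆-I+∙ {{ℕ.m^n≢0 ℓ i {{prime⇒nonZero ℓ-prime}}}} x B Y
    (commute⇒∣⁅⁆ X Y (≈-weaken {X = X *ᴹ Y} {Y *ᴹ X} ℓⁱℓᵏ∣ℓˢ XY≈YX)))
  where
  X : Mat
  X = x I+ + (ℓ ^ i) ∙ B
  ℓⁱℓᵏ∣ℓˢ : ℓ ^ i * ℓ ^ k ∣ ℓ ^ s
  ℓⁱℓᵏ∣ℓˢ = subst (_∣ ℓ ^ s) (ℕ.^-distribˡ-+-* ℓ i k) (^-monoʳ-∣ ℓ i+k≤s)

centralizer-generator : ∀ {ℓ s k} X → Prime ℓ → k + k ≤ suc s → ¬ IsScalarMod (ℓ ^ k) X →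
  ∃ λ B → ¬ IsScalarMod ℓ B × (∀ Y → X *ᴹ Y ≈ Y *ᴹ X [mod ℓ ^ s ] → InSpan (ℓ ^ k) B Y)
centralizer-generator {ℓ} {s} {k} X ℓ-prime 2k≤1+s ¬scalarᵏ
  with ∃-boundary (λ i → isScalarMod? (ℓ ^ i) X) (isScalarMod-1 X) ¬scalarᵏ
... | i , i<k , scalarⁱ , ¬scalarⁱ⁺¹ with isScalarMod⇒I+∙ X scalarⁱ
... | x , B , refl = B , ¬scalar , λ Y → centralizer-I+∙ {i = i} x B Y ℓ-prime ¬scalar i+k≤s
  where
  ¬scalar : ¬ IsScalarMod ℓ B
  ¬scalar = ¬scalarⁱ⁺¹ ∘ isScalarMod-I+∙ x B
  i+k≤s : i + k ≤ s
  i+k≤s = s≤s⁻¹ (ℕ.≤-trans (ℕ.+-monoˡ-≤ k i<k) 2k≤1+s)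

commuting-generator : ∀ {ℓ s k} → Prime ℓ → k + k ≤ suc s → (H : List Mat) →
  (∀ {X Y} → X ∈ H → Y ∈ H → X *ᴹ Y ≈ Y *ᴹ X [mod ℓ ^ s ]) →
  ∃ λ B → ¬ IsScalarMod ℓ B × (∀ {X} → X ∈ H → InSpan (ℓ ^ k) B X)
commuting-generator {ℓ} {s} {k} ℓ-prime 2k≤1+s H commute = by-cases (all? (isScalarMod? (ℓ ^ k)) H)
  where
  by-cases : Dec (All (IsScalarMod (ℓ ^ k)) H) →
             ∃ λ B → ¬ IsScalarMod ℓ B × (∀ {X} → X ∈ H → InSpan (ℓ ^ k) B X)
  by-cases (yes scalar) =
    E₁₂ , E₁₂-nonScalarMod ℓ-prime , λ {X} X∈H → isScalarMod⇒inSpan E₁₂ X (All.lookup scalar X∈H)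
  by-cases (no ¬scalar) =
    let X , X∈H , ¬scalarX = find (¬All⇒Any¬ (isScalarMod? (ℓ ^ k)) H ¬scalar)
        B , ¬scalarB , span = centralizer-generator {k = k} X ℓ-prime 2k≤1+s ¬scalarX
    in  B , ¬scalarB , λ {Y} Y∈H → span Y (commute X∈H Y∈H)

residue : ∀ n .{{_ : NonZero n}} → ℤ → Fin n
residue n z = fromℕ< (n%ℕd<d z n)

residue-≡ℤ : ∀ n .{{_ : NonZero n}} z → z ≡ℤ + toℕ (residue n z) [mod n ]
residue-≡ℤ n z = subst (λ r → z ≡ℤ + r [mod n ]) (sym (Fin.toℕ-fromℕ< (n%ℕd<d z n))) (≡ℤ-%ℕ z n)

residue-injective : ∀ n .{{_ : NonZero n}} {z w} → residue n z ≡ residue n w → z ≡ℤ w [mod n ]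
residue-injective n {z} {w} eq =
  ≡ℤ-trans {x = z} {+ toℕ (residue n w)} {w}
    (subst (λ i → z ≡ℤ + toℕ i [mod n ]) eq (residue-≡ℤ n z)) (≡ℤ-sym {x = w} (residue-≡ℤ n w))

residueᴹ : ∀ n .{{_ : NonZero n}} → Mat → Fin (n * n * (n * n))
residueᴹ n X =
  combine (combine (residue n (a X)) (residue n (b X))) (combine (residue n (c X)) (residue n (d X)))

residueᴹ-injective : ∀ n .{{_ : NonZero n}} X Y → residueᴹ n X ≡ residueᴹ n Y → X ≈ Y [mod n ]
residueᴹ-injective n X Y eq
  with Fin.combine-injective (combine (residue n (a X)) (residue n (b X))) _
                             (combine (residue n (a Y)) (residue n (b Y))) _ eq
... | ab≡ , cd≡ with Fin.combine-injective (residue n (a X)) _ (residue n (a Y)) _ ab≡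
                   | Fin.combine-injective (residue n (c X)) _ (residue n (c Y)) _ cd≡
... | a≡ , b≡ | c≡ , d≡ =
  residue-injective n {a X} a≡ , residue-injective n {b X} b≡ ,
  residue-injective n {c X} c≡ , residue-injective n {d X} d≡

record ReducedSpan (m : ℕ) (B X : Mat) : Set where
  constructor reduced
  field
    x y : Fin m
    approximation : X ≈ + toℕ x I+ + toℕ y ∙ B [mod m ]

reduce : ∀ {m} .{{_ : NonZero m}} B X → InSpan m B X → ReducedSpan m B X
reduce {m} B X (x , y , X≈) =
  reduced x̄ ȳ (≈-trans {X = X} {x I+ y ∙ B} X≈
    (I+∙-cong {x = x} {+ toℕ x̄} {y} {+ toℕ ȳ} B (residue-≡ℤ m x) (residue-≡ℤ m y)))
  where
  x̄ ȳ : Fin m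
  x̄ = residue m x
  ȳ = residue m y

spanCode : ∀ {m n B X} .{{_ : NonZero n}} → ReducedSpan m B X → Fin (m * m * (n * n * (n * n)))
spanCode {n = n} {X = X} (reduced x y X≈) = combine (combine x y) (residueᴹ n (quotientᴹ X _ X≈))

spanCode-injective : ∀ {m n B X X′} .{{_ : NonZero n}} (r : ReducedSpan m B X) (r′ : ReducedSpan m B X′) →
                     spanCode {n = n} r ≡ spanCode r′ → X ≈ X′ [mod m * n ]
spanCode-injective {n = n} {B} {X} {X′} (reduced x y X≈) (reduced x′ y′ X′≈) eq
  with Fin.combine-injective (combine x y) _ (combine x′ y′) _ eq
... | xy≡ , W≡ with Fin.combine-injective x y x′ y′ xy≡
... | refl , refl =
  ≈-lift X X′ (+ toℕ x I+ + toℕ y ∙ B) X≈ X′≈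
    (residueᴹ-injective n (quotientᴹ X _ X≈) (quotientᴹ X′ _ X′≈) W≡)

AllPairs-lookup : ∀ {A : Set} {R : A → A → Set} {xs} → AllPairs R xs →
                  ∀ {i j} → i Fin.< j → R (lookup xs i) (lookup xs j)
AllPairs-lookup (Rx ∷ _) {Fin.zero} {Fin.suc j} _ = All.lookup Rx (∈-lookup j)
AllPairs-lookup (_ ∷ Rxs) {Fin.suc i} {Fin.suc j} i<j = AllPairs-lookup Rxs (s≤s⁻¹ i<j)

distinct⇒length≤ : ∀ {A : Set} (_∼_ : A → A → Set) {xs : List A} {K} →
                   AllPairs (λ x y → ¬ x ∼ y) xs → (f : ∀ {x} → x ∈ xs → Fin K) →
                   (∀ {x y} (p : x ∈ xs) (q : y ∈ xs) → f p ≡ f q → x ∼ y) → length xs ≤ K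
distinct⇒length≤ _ {xs} {K} distinct f f-injective with K ℕ.<? length xs
... | no K≮length = ℕ.≮⇒≥ K≮length
... | yes K<length with Fin.pigeonhole K<length (f ∘ ∈-lookup)
... | i , j , i<j , fi≡fj =
  ⊥-elim (AllPairs-lookup distinct i<j (f-injective (∈-lookup i) (∈-lookup j) fi≡fj))

length≤-span : ∀ {m n} .{{_ : NonZero m}} .{{_ : NonZero n}} B (H : List Mat) →
               AllPairs (λ X Y → ¬ X ≈ Y [mod m * n ]) H → (∀ {X} → X ∈ H → InSpan m B X) →
               length H ≤ m * m * (n * n * (n * n))
length≤-span {m} {n} B H distinct span =
  distinct⇒length≤ (λ X Y → X ≈ Y [mod m * n ]) distinct (spanCode {n = n} ∘ reduced-span)
    (λ p q → spanCode-injective (reduced-span p) (reduced-span q))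
  where
  reduced-span : ∀ {X} → X ∈ H → ReducedSpan m B X
  reduced-span {X} X∈H = reduce B X (span X∈H)

⌈n/2⌉+⌈n/2⌉≤1+n : ∀ n → ⌈ n /2⌉ + ⌈ n /2⌉ ≤ suc n
⌈n/2⌉+⌈n/2⌉≤1+n n = ℕ.≤-trans (ℕ.+-monoʳ-≤ ⌈ n /2⌉ (ℕ.⌊n/2⌋≤⌈n/2⌉ (suc n)))
                              (ℕ.≤-reflexive (ℕ.⌊n/2⌋+⌈n/2⌉≡n (suc n)))

m²n⁴≤[mn]³ : ∀ {m n} → n ≤ m → m * m * (n * n * (n * n)) ≤ m * n * (m * n) * (m * n)
m²n⁴≤[mn]³ {m} {n} n≤m = begin
  m * m * (n * n * (n * n)) ≡⟨ ℕ-Ring.solve (m ∷ n ∷ []) ⟩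
  m * n * (m * n) * (n * n) ≤⟨ ℕ.*-monoʳ-≤ (m * n * (m * n)) (ℕ.*-monoˡ-≤ n n≤m) ⟩
  m * n * (m * n) * (m * n) ∎
  where open ℕ.≤-Reasoning

^-cube : ∀ ℓ s → ℓ ^ s * ℓ ^ s * ℓ ^ s ≡ ℓ ^ (3 * s)
^-cube ℓ s = trans (cube (ℓ ^ s)) (trans (ℕ.^-*-assoc ℓ s 3) (cong (ℓ ^_) (ℕ.*-comm s 3)))
  where
  cube : ∀ x → x * x * x ≡ x * (x * (x * 1))
  cube = ℕ-Ring.solve-∀

proposition5p5 : (ℓ s : ℕ) → Prime ℓ → .{{_ : NonZero s}} →
    (H : List Mat) →
    AllPairs (λ X Y → ¬ (X ≈ Y [mod ℓ ^ s ])) H →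
    (∀ {X} → X ∈ H → IsInvertible (ℓ ^ s) X) →
    (∃ λ E → E ∈ H × E ≈ I [mod ℓ ^ s ]) →
    (∀ {X Y} → X ∈ H → Y ∈ H → ∃ λ Z → Z ∈ H × Z ≈ X *ᴹ Y [mod ℓ ^ s ]) →
    (∀ {X} → X ∈ H → ∃ λ Y → Y ∈ H × X *ᴹ Y ≈ I [mod ℓ ^ s ]) →
    (∀ {X Y} → X ∈ H → Y ∈ H → X *ᴹ Y ≈ Y *ᴹ X [mod ℓ ^ s ]) →
    (∃ λ A′ → ¬ IsScalarMod ℓ A′ ×
       (∀ {X} → X ∈ H → InSubring (ℓ ^ ⌈ s /2⌉) A′ X))
    × length H ≤ ℓ ^ (3 * s)
proposition5p5 ℓ s ℓ-prime H distinct _ _ _ _ commute =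
  let A′ , A′-nonscalar , span = commuting-generator {k = ⌈ s /2⌉} ℓ-prime (⌈n/2⌉+⌈n/2⌉≤1+n s) H commute
  in  (A′ , A′-nonscalar , inSpan⇒inSubring ∘ span) ,
      (begin
        length H                        ≤⟨ length≤-span {m} {n} {{m≢0}} {{n≢0}} A′ H distinct′ span ⟩
        m * m * (n * n * (n * n))       ≤⟨ m²n⁴≤[mn]³ (ℕ.^-monoʳ-≤ ℓ {{ℓ≢0}} (ℕ.⌊n/2⌋≤⌈n/2⌉ s)) ⟩
        m * n * (m * n) * (m * n)       ≡⟨ cong (λ k → k * k * k) mn≡ℓˢ ⟩
        ℓ ^ s * ℓ ^ s * ℓ ^ s           ≡⟨ ^-cube ℓ s ⟩
        ℓ ^ (3 * s)                     ∎)
  where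
  open ℕ.≤-Reasoning
  ℓ≢0 : NonZero ℓ
  ℓ≢0 = prime⇒nonZero ℓ-prime
  m n : ℕ
  m = ℓ ^ ⌈ s /2⌉
  n = ℓ ^ ⌊ s /2⌋
  m≢0 : NonZero m
  m≢0 = ℕ.m^n≢0 ℓ ⌈ s /2⌉ {{ℓ≢0}}
  n≢0 : NonZero n
  n≢0 = ℕ.m^n≢0 ℓ ⌊ s /2⌋ {{ℓ≢0}}
  mn≡ℓˢ : m * n ≡ ℓ ^ s
  mn≡ℓˢ = trans (sym (ℕ.^-distribˡ-+-* ℓ ⌈ s /2⌉ ⌊ s /2⌋))
                (cong (ℓ ^_) (trans (ℕ.+-comm ⌈ s /2⌉ ⌊ s /2⌋) (ℕ.⌊n/2⌋+⌈n/2⌉≡n s)))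
  distinct′ : AllPairs (λ X Y → ¬ X ≈ Y [mod m * n ]) H
  distinct′ = subst (λ M → AllPairs (λ X Y → ¬ X ≈ Y [mod M ]) H) (sym mn≡ℓˢ) distinct
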